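{- Let $s$ be a composition, $w$ a Stirling $s$-permutation and $A$ a subset of its ascents. Then for all $1\le a<c\le n$, $\#_{w+A}(c,a)=\#_w(c,a)+1$ if $(a,c)$ is $A$-dependent in $w$, and $\#_{w+A}(c,a)=\#_w(c,a)$ otherwise.
   Context: $s=(s_1,\dots,s_n)$ is a composition. A Stirling $s$-permutation is a word with each $i\in[n]$ occurring $s_i$ times avoiding $121$ (no $i<j$ with a $j$ between two $i$'s). The $a$-block of $w$ is the shortest consecutive substring containing all occurrences of $a$. For $a<c$, $(a,c)$ is an ascent of $w$ if $ac$ is a consecutive substring, and $\#_w(c,a)$ is the number of occurrences of $c$ preceding the $a$-block. For a set $A$ of ascents, $w+A$ is the Stirling $s$-permutation whose inversion numbers $\#_{w+A}$ form the transitive closure of $\mathrm{inv}(w)+A$, i.e. the pointwise smallest function $I$ on pairs $a<c$ with $I(c,a)\ge\#_w(c,a)+[(a,c)\in A]$ that is transitive: for all $a<b<c$, $I(b,a)=0$ or $I(c,a)\ge I(c,b)$. A pair $(a,c)$ with $a<c$ and $\#_w(c,a)<s_c$ is $A$-dependent in $w$ if there is a sequence $a\le b_1<\dots<b_k<b_{k+1}=c$ with: (i) $b_1$ is the greatest letter strictly smaller than $c$ such that the $a$-block is contained in the $b_1$-block; (ii) for $i\in[k-1]$ the $b_i$-block is directly followed by the $b_{i+1}$-block; (iii) the $b_k$-block is directly followed by an occurrence of $c$; (iv) $(b_i,b_{i+1})\in A$ for all $i\in[k]$. -}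

module Defs where

open import Data.Nat as ℕ using (ℕ; zero; suc; _∸_; _≤_)
open import Data.Fin as Fin using (Fin; _≟_)
open import Data.List using (List; []; _∷_; _++_; length; reverse; take)
open import Data.Maybe using (Maybe; just; nothing)
open import Data.Product using (Σ; ∃; _×_; _,_)
open import Data.Sum using (_⊎_)
open import Relation.Nullary using (¬_; yes; no)
open import Relation.Binary.PropositionalEquality using (_≡_)

-- Letters are elements of Fin n (letter i+1 of the paper is represented by i : Fin n);
-- the order on letters is the order of Fin n.

IsComposition : ∀ {n} → (Fin n → ℕ) → Set
IsComposition s = ∀ i → 1 ≤ s i

count : ∀ {n} → Fin n → List (Fin n) → ℕ
count x [] = 0
count x (y ∷ w) with x ≟ y
... | yes _ = suc (count x w)
... | no  _ = count x w

_‼_ : ∀ {n} → List (Fin n) → ℕ → Maybe (Fin n)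
[] ‼ p = nothing
(y ∷ w) ‼ zero = just y
(y ∷ w) ‼ suc p = w ‼ p

-- position of the first occurrence of x (length of w if x does not occur)
firstOcc : ∀ {n} → Fin n → List (Fin n) → ℕ
firstOcc x [] = 0
firstOcc x (y ∷ w) with x ≟ y
... | yes _ = 0
... | no  _ = suc (firstOcc x w)

lastOcc : ∀ {n} → Fin n → List (Fin n) → ℕ
lastOcc x w = length w ∸ suc (firstOcc x (reverse w))

-- The x-block of w is the factor of w from position firstOcc x w to lastOcc x w.

Avoids121 : ∀ {n} → List (Fin n) → Set
Avoids121 w = ¬ (Σ ℕ λ p → Σ ℕ λ q → Σ ℕ λ r → Σ (Fin _) λ i → Σ (Fin _) λ j →
  (p ℕ.< q) × (q ℕ.< r) × (i Fin.< j) ×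
  (w ‼ p ≡ just i) × (w ‼ q ≡ just j) × (w ‼ r ≡ just i))

StirlingPerm : ∀ {n} → (Fin n → ℕ) → List (Fin n) → Set
StirlingPerm s w = (∀ i → count i w ≡ s i) × Avoids121 w

Ascent : ∀ {n} → List (Fin n) → Fin n → Fin n → Set
Ascent w a c = (a Fin.< c) × Σ (List _) λ u → Σ (List _) λ v → w ≡ u ++ (a ∷ c ∷ v)

-- #_w(c,a): number of occurrences of c preceding the a-block
inv : ∀ {n} → List (Fin n) → Fin n → Fin n → ℕ
inv w c a = count c (take (firstOcc a w) w)

BlockIn : ∀ {n} → List (Fin n) → Fin n → Fin n → Set
BlockIn w a b = (firstOcc b w ≤ firstOcc a w) × (lastOcc a w ≤ lastOcc b w)

BlockFollowedByBlock : ∀ {n} → List (Fin n) → Fin n → Fin n → Set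
BlockFollowedByBlock w b b' = suc (lastOcc b w) ≡ firstOcc b' w

BlockFollowedByLetter : ∀ {n} → List (Fin n) → Fin n → Fin n → Set
BlockFollowedByLetter w b c = w ‼ suc (lastOcc b w) ≡ just c

data Chain {n} (w : List (Fin n)) (A : Fin n → Fin n → Set) : Fin n → Fin n → Set where
  lastStep : ∀ {b c} → b Fin.< c → BlockFollowedByLetter w b c → A b c → Chain w A b c
  step : ∀ {b b' c} → b Fin.< b' → BlockFollowedByBlock w b b' → A b b' →
         Chain w A b' c → Chain w A b c

Dependent : ∀ {n} → (Fin n → ℕ) → List (Fin n) → (Fin n → Fin n → Set) → Fin n → Fin n → Set
Dependent s w A a c =
  (a Fin.< c) × (inv w c a ℕ.< s c) ×
  Σ (Fin _) λ b₁ →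
    (a Fin.≤ b₁) × (b₁ Fin.< c) × BlockIn w a b₁ ×
    (∀ b → b Fin.< c → BlockIn w a b → b Fin.≤ b₁) ×
    Chain w A b₁ c

-- I (on pairs a < c, written I c a) is ≥ inv(w) + A and transitive
AboveInvPlusA : ∀ {n} → List (Fin n) → (Fin n → Fin n → Set) → (Fin n → Fin n → ℕ) → Set
AboveInvPlusA w A I =
  (∀ a c → a Fin.< c → inv w c a ≤ I c a) ×
  (∀ a c → a Fin.< c → A a c → suc (inv w c a) ≤ I c a) ×
  (∀ a b c → a Fin.< b → b Fin.< c → (I b a ≡ 0) ⊎ (I c b ≤ I c a))

-- I is the transitive closure of inv(w) + A: the pointwise smallest such function
IsTransClosure : ∀ {n} → List (Fin n) → (Fin n → Fin n → Set) → (Fin n → Fin n → ℕ) → Set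
IsTransClosure w A I =
  AboveInvPlusA w A I ×
  (∀ J → AboveInvPlusA w A J → ∀ a c → a Fin.< c → I c a ≤ J c a)

-- Write I for #_{w+A}.  If (a,c) is A-dependent through b₁ < … < b_k < c, each ascent
-- (b_i, b_{i+1}) ∈ A raises I by one over #_w, and transitivity of I carries the increase along
-- the chain down to (c,a).  Conversely, I(c,a) ≤ m as soon as m bounds #_w(c,a), the constraint
-- coming from A, and I(c,b) for every a < b < c with I(b,a) > 0: otherwise lowering the single
-- entry I(c,a) to m would give a smaller admissible function.  By induction on c, and downwards
-- on a, such b have #_w(c,b) ≤ #_w(c,a) by 121-avoidance; and if moreover (b,c) is dependent
-- with #_w(c,b) = #_w(c,a), the blocks of the two chains nest so that they glue into a chain
-- making (a,c) dependent.

module Submission where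

open import Defs
open import Data.Empty using (⊥-elim)
open import Data.Fin as Fin using (Fin; _≟_)
open import Data.Fin.Induction using (<-wellFounded; >-wellFounded)
open import Data.Fin.Properties as Finₚ using (any?; <-cmp)
open import Data.List using (List; []; _∷_; _++_; length; reverse; take; [_])
open import Data.List.Properties using (unfold-reverse; length-reverse)
open import Data.Maybe using (just)
open import Data.Maybe.Properties using (just-injective)
open import Data.Nat as ℕ using (ℕ; zero; suc; _+_; _∸_; _≤_; _<_; z≤n; s≤s; z<s)
open import Data.Nat.Properties as ℕₚ
  using (≤-refl; ≤-trans; <⇒≤; ≤-<-trans; <-≤-trans; ≤-antisym; n≤1+n; ≤∧≢⇒<; ≰⇒>; ≮⇒≥;
         m≤n⇒m<n∨m≡n; _≤?_; _<?_)
open import Data.Product using (Σ; ∃; _×_; _,_; proj₁; proj₂)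
open import Data.Sum using (_⊎_; inj₁; inj₂)
open import Function using (_∘_)
open import Induction.WellFounded using (Acc; acc)
open import Relation.Binary.Definitions using (tri<; tri≈; tri>)
open import Relation.Binary.PropositionalEquality using (_≡_; refl; sym; trans; cong; subst; subst₂; module ≡-Reasoning)
open import Relation.Nullary using (¬_; yes; no; Dec)
open import Relation.Nullary.Decidable using (_×-dec_; decidable-stable; ¬¬-excluded-middle)

module _ {n : ℕ} where

  ‼⇒<length : ∀ (w : List (Fin n)) q {x} → w ‼ q ≡ just x → q < length w
  ‼⇒<length (y ∷ w) zero    _ = z<s
  ‼⇒<length (y ∷ w) (suc q) e = s≤s (‼⇒<length w q e)

  firstOcc-≤ : ∀ {x} (w : List (Fin n)) q → w ‼ q ≡ just x → firstOcc x w ≤ q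
  firstOcc-≤ {x} (y ∷ w) q e with x ≟ y
  ... | yes _ = z≤n
  firstOcc-≤ (y ∷ w) zero    e | no x≢y = ⊥-elim (x≢y (sym (just-injective e)))
  firstOcc-≤ (y ∷ w) (suc q) e | no _   = s≤s (firstOcc-≤ w q e)

  ‼-firstOcc : ∀ {x} (w : List (Fin n)) q → w ‼ q ≡ just x → w ‼ firstOcc x w ≡ just x
  ‼-firstOcc {x} (y ∷ w) q e with x ≟ y
  ... | yes x≡y = cong just (sym x≡y)
  ‼-firstOcc (y ∷ w) zero    e | no x≢y = ⊥-elim (x≢y (sym (just-injective e)))
  ‼-firstOcc (y ∷ w) (suc q) e | no _   = ‼-firstOcc w q e

  ‼-++ʳ : ∀ (u v : List (Fin n)) j → (u ++ v) ‼ (length u + j) ≡ v ‼ j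
  ‼-++ʳ []      v j = refl
  ‼-++ʳ (y ∷ u) v j = ‼-++ʳ u v j

  ‼-++ˡ : ∀ (u v : List (Fin n)) {j} → j < length u → (u ++ v) ‼ j ≡ u ‼ j
  ‼-++ˡ (y ∷ u) v {zero}  _         = refl
  ‼-++ˡ (y ∷ u) v {suc j} (s≤s j<u) = ‼-++ˡ u v j<u

  ‼-reverse : ∀ (w : List (Fin n)) {i} → i < length w → reverse w ‼ i ≡ w ‼ (length w ∸ suc i)
  ‼-reverse (y ∷ w) {i} i<1+w rewrite unfold-reverse y w with m≤n⇒m<n∨m≡n (ℕₚ.≤-pred i<1+w)
  ... | inj₁ i<w = begin
    (reverse w ++ [ y ]) ‼ i              ≡⟨ ‼-++ˡ (reverse w) [ y ] (subst (i <_) (sym (length-reverse w)) i<w) ⟩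
    reverse w ‼ i                         ≡⟨ ‼-reverse w i<w ⟩
    w ‼ (length w ∸ suc i)                ≡⟨ cong ((y ∷ w) ‼_) (sym (ℕₚ.+-∸-assoc 1 i<w)) ⟩
    (y ∷ w) ‼ (suc (length w) ∸ suc i)    ∎
    where open ≡-Reasoning
  ... | inj₂ refl = begin
    (reverse w ++ [ y ]) ‼ length w                  ≡⟨ cong ((reverse w ++ [ y ]) ‼_)
                                                          (sym (trans (ℕₚ.+-identityʳ _) (length-reverse w))) ⟩
    (reverse w ++ [ y ]) ‼ (length (reverse w) + 0)  ≡⟨ ‼-++ʳ (reverse w) [ y ] 0 ⟩
    just y                                           ≡⟨ cong ((y ∷ w) ‼_) (sym (ℕₚ.n∸n≡0 (length w))) ⟩
    (y ∷ w) ‼ (length w ∸ length w)                  ∎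
    where open ≡-Reasoning

  module _ {x : Fin n} (w : List (Fin n)) {q} (w[q]≡x : w ‼ q ≡ just x) where
    private
      L : ℕ
      L = length w
      q<L : q < L
      q<L = ‼⇒<length w q w[q]≡x
      mirror : ℕ
      mirror = L ∸ suc q
      mirror<L : mirror < L
      mirror<L = ℕₚ.∸-monoʳ-< z<s q<L
      mirror-mirror : L ∸ suc mirror ≡ q
      mirror-mirror = trans (cong (L ∸_) (sym (ℕₚ.+-∸-assoc 1 q<L))) (ℕₚ.m∸[m∸n]≡n (<⇒≤ q<L))
      reversed-hit : reverse w ‼ mirror ≡ just x
      reversed-hit = trans (‼-reverse w mirror<L) (trans (cong (w ‼_) mirror-mirror) w[q]≡x)
      F : ℕ
      F = firstOcc x (reverse w)
      F<L : F < L
      F<L = subst (F <_) (length-reverse w)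
              (‼⇒<length (reverse w) F (‼-firstOcc (reverse w) mirror reversed-hit))

    ≤-lastOcc : q ≤ lastOcc x w
    ≤-lastOcc = subst (_≤ lastOcc x w) mirror-mirror
                  (ℕₚ.∸-monoʳ-≤ L (s≤s (firstOcc-≤ (reverse w) mirror reversed-hit)))

    ‼-lastOcc : w ‼ lastOcc x w ≡ just x
    ‼-lastOcc = trans (sym (‼-reverse w F<L)) (‼-firstOcc (reverse w) mirror reversed-hit)

  count-take-mono : ∀ (c : Fin n) w {p q} → p ≤ q → count c (take p w) ≤ count c (take q w)
  count-take-mono c _       {zero}  _         = z≤n
  count-take-mono c []      {suc p} _         = z≤n
  count-take-mono c (y ∷ w) {suc p} (s≤s p≤q) with c ≟ y
  ... | yes _ = s≤s (count-take-mono c w p≤q)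
  ... | no  _ = count-take-mono c w p≤q

  count-take-hit : ∀ (c : Fin n) w r → w ‼ r ≡ just c → suc (count c (take r w)) ≤ count c (take (suc r) w)
  count-take-hit c (y ∷ w) zero e with c ≟ y
  ... | yes _   = ≤-refl
  ... | no  c≢y = ⊥-elim (c≢y (sym (just-injective e)))
  count-take-hit c (y ∷ w) (suc r) e with c ≟ y
  ... | yes _ = s≤s (count-take-hit c w r e)
  ... | no  _ = count-take-hit c w r e

  count-take-miss : ∀ (c : Fin n) w r → ¬ w ‼ r ≡ just c → count c (take (suc r) w) ≤ count c (take r w)
  count-take-miss c []      r       _ = z≤n
  count-take-miss c (y ∷ w) zero e with c ≟ y
  ... | yes c≡y = ⊥-elim (e (cong just (sym c≡y)))
  ... | no  _   = z≤n
  count-take-miss c (y ∷ w) (suc r) e with c ≟ y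
  ... | yes _ = s≤s (count-take-miss c w r e)
  ... | no  _ = count-take-miss c w r e

  count-take-≤ : ∀ (c : Fin n) w p → count c (take p w) ≤ count c w
  count-take-≤ c _       zero    = z≤n
  count-take-≤ c []      (suc p) = z≤n
  count-take-≤ c (y ∷ w) (suc p) with c ≟ y
  ... | yes _ = s≤s (count-take-≤ c w p)
  ... | no  _ = count-take-≤ c w p

  count-take-< : ∀ (c : Fin n) w {p q r} → w ‼ r ≡ just c → p ≤ r → r < q →
                 count c (take p w) < count c (take q w)
  count-take-< c w {r = r} w[r]≡c p≤r r<q =
    ≤-trans (s≤s (count-take-mono c w p≤r)) (≤-trans (count-take-hit c w r w[r]≡c) (count-take-mono c w r<q))

  count-take-gap : ∀ (c : Fin n) w p q → (∀ r → p ≤ r → r < q → ¬ w ‼ r ≡ just c) →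
                   count c (take q w) ≤ count c (take p w)
  count-take-gap c w p zero    _   = z≤n
  count-take-gap c w p (suc q) gap with p ≤? q
  ... | yes p≤q = ≤-trans (count-take-miss c w q (gap q p≤q ≤-refl))
                          (count-take-gap c w p q λ r p≤r r<q → gap r p≤r (ℕₚ.m<n⇒m<1+n r<q))
  ... | no  p≰q = count-take-mono c w (≰⇒> p≰q)

  count-take-pos⇒firstOcc< : ∀ (x : Fin n) w q → 0 < count x (take q w) → firstOcc x w < q
  count-take-pos⇒firstOcc< x w q 0<count with firstOcc x w <? q
  ... | yes first<q = first<q
  ... | no  first≮q = ⊥-elim (ℕₚ.<-irrefl refl (<-≤-trans 0<count (count-take-gap x w 0 q
          λ r _ r<q w[r]≡x → first≮q (≤-<-trans (firstOcc-≤ w r w[r]≡x) r<q))))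

  count-pos⇒‼-firstOcc : ∀ (x : Fin n) w → 1 ≤ count x w → w ‼ firstOcc x w ≡ just x
  count-pos⇒‼-firstOcc x (y ∷ w) h with x ≟ y
  ... | yes x≡y = cong just (sym x≡y)
  ... | no  _   = count-pos⇒‼-firstOcc x w h

  ∃-largest : ∀ {P : Fin n → Set} → (∀ x → Dec (P x)) → ∀ {a} → P a →
              ∃ λ y → P y × (∀ z → P z → z Fin.≤ y)
  ∃-largest {P} P? {a} Pa = go a (>-wellFounded a) Pa
    where
    go : ∀ x → Acc Fin._>_ x → P x → ∃ λ y → P y × (∀ z → P z → z Fin.≤ y)
    go x (acc larger) Px with any? (λ z → x Fin.<? z ×-dec P? z)
    ... | yes (z , x<z , Pz) = go z (larger x<z) Pz
    ... | no  ∄larger        = x , Px , λ z Pz → ≮⇒≥ (λ x<z → ∄larger (z , x<z , Pz))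

module Blocks {n} (w : List (Fin n)) (occurs : ∀ x → 1 ≤ count x w) (avoids121 : Avoids121 w) where

  first last : Fin n → ℕ
  first x = firstOcc x w
  last  x = lastOcc x w

  InBlock : Fin n → ℕ → Set
  InBlock x q = first x ≤ q × q ≤ last x

  ‼-first : ∀ x → w ‼ first x ≡ just x
  ‼-first x = count-pos⇒‼-firstOcc x w (occurs x)

  ‼-last : ∀ x → w ‼ last x ≡ just x
  ‼-last x = ‼-lastOcc w (‼-first x)

  ‼-functional : ∀ {q x y} → w ‼ q ≡ just x → w ‼ q ≡ just y → x ≡ y
  ‼-functional w[q]≡x w[q]≡y = just-injective (trans (sym w[q]≡x) w[q]≡y)

  first-≤ : ∀ {x q} → w ‼ q ≡ just x → first x ≤ q
  first-≤ {q = q} = firstOcc-≤ w q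

  ≤-last : ∀ {x q} → w ‼ q ≡ just x → q ≤ last x
  ≤-last = ≤-lastOcc w

  first≤last : ∀ x → first x ≤ last x
  first≤last x = first-≤ (‼-last x)

  first-injective : ∀ {x y} → first x ≡ first y → x ≡ y
  first-injective {x} {y} eq = ‼-functional (‼-first x) (subst (λ q → w ‼ q ≡ just y) (sym eq) (‼-first y))

  last-injective : ∀ {x y} → last x ≡ last y → x ≡ y
  last-injective {x} {y} eq = ‼-functional (‼-last x) (subst (λ q → w ‼ q ≡ just y) (sym eq) (‼-last y))

  larger-∉-block : ∀ {x y q} → x Fin.< y → InBlock x q → ¬ w ‼ q ≡ just y
  larger-∉-block {x} {y} {q} x<y (first≤q , q≤last) w[q]≡y
    with m≤n⇒m<n∨m≡n first≤q | m≤n⇒m<n∨m≡n q≤last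
  ... | inj₂ refl | _         = Finₚ.<⇒≢ x<y (‼-functional (‼-first x) w[q]≡y)
  ... | inj₁ _    | inj₂ refl = Finₚ.<⇒≢ x<y (‼-functional (‼-last x) w[q]≡y)
  ... | inj₁ f<q  | inj₁ q<l  =
    avoids121 (first x , q , last x , x , y , f<q , q<l , x<y , ‼-first x , w[q]≡y , ‼-last x)

  blocks-nested : ∀ {x y q} → x Fin.< y → InBlock x q → InBlock y q → BlockIn w x y
  blocks-nested {x} {y} x<y (fx≤q , q≤lx) (fy≤q , q≤ly) = fy≤fx , lx≤ly
    where
    fy≤fx : first y ≤ first x
    fy≤fx with first y ≤? first x
    ... | yes le = le
    ... | no  nle = ⊥-elim (larger-∉-block x<y (<⇒≤ (≰⇒> nle) , ≤-trans fy≤q q≤lx) (‼-first y))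
    lx≤ly : last x ≤ last y
    lx≤ly with last x ≤? last y
    ... | yes le = le
    ... | no  nle = ⊥-elim (larger-∉-block x<y (≤-trans fx≤q q≤ly , <⇒≤ (≰⇒> nle)) (‼-last y))

  BlockIn-refl : ∀ {x} → BlockIn w x x
  BlockIn-refl = ≤-refl , ≤-refl

  first-∈-block⇒BlockIn : ∀ {a z} → InBlock z (first a) → BlockIn w a z
  first-∈-block⇒BlockIn {a} {z} a∈z with <-cmp a z
  ... | tri< a<z _ _ = blocks-nested a<z (≤-refl , first≤last a) a∈z
  ... | tri≈ _ refl _ = BlockIn-refl
  ... | tri> _ _ z<a = ⊥-elim (Finₚ.<⇒≢ z<a (first-injective (≤-antisym (proj₁ a∈z) fa≤fz)))
    where
    fa≤fz : first a ≤ first z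
    fa≤fz = proj₁ (blocks-nested z<a a∈z (≤-refl , first≤last a))

  BlockIn-join : ∀ {a x y} → BlockIn w a x → BlockIn w a y → x Fin.≤ y → BlockIn w x y
  BlockIn-join {a} {x} {y} (fx≤fa , la≤lx) (fy≤fa , la≤ly) x≤y with x ≟ y
  ... | yes refl = BlockIn-refl
  ... | no  x≢y  = blocks-nested (Finₚ.≤∧≢⇒< x≤y x≢y) (fx≤fa , ≤-trans (first≤last a) la≤lx)
                                                     (fy≤fa , ≤-trans (first≤last a) la≤ly)

  module _ {A : Fin n → Fin n → Set} where

    chainEnd : ∀ {x c} → Chain w A x c → ℕ
    chainEnd {x} (lastStep _ _ _) = suc (last x)
    chainEnd (step _ _ _ ch)      = chainEnd ch

    ‼-chainEnd : ∀ {x c} (ch : Chain w A x c) → w ‼ chainEnd ch ≡ just c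
    ‼-chainEnd (lastStep _ followed _) = followed
    ‼-chainEnd (step _ _ _ ch)         = ‼-chainEnd ch

    last<chainEnd : ∀ {x c} (ch : Chain w A x c) → last x < chainEnd ch
    last<chainEnd (lastStep _ _ _)                = ≤-refl
    last<chainEnd (step {b' = x′} _ followed _ ch) =
      ≤-trans (ℕₚ.≤-reflexive followed) (≤-trans (first≤last x′) (<⇒≤ (last<chainEnd ch)))

    Chain⇒< : ∀ {x c} → Chain w A x c → x Fin.< c
    Chain⇒< (lastStep x<c _ _) = x<c
    Chain⇒< (step x<x′ _ _ ch) = Finₚ.<-trans x<x′ (Chain⇒< ch)

    chain-covers : ∀ {x c q} (ch : Chain w A x c) → first x ≤ q → q < chainEnd ch →
                   ∃ λ z → Chain w A z c × InBlock z q
    chain-covers {x} ch@(lastStep _ _ _) x≤q q<end = x , ch , x≤q , ℕₚ.≤-pred q<end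
    chain-covers {x} {q = q} ch@(step _ followed _ ch′) x≤q q<end with q ≤? last x
    ... | yes q≤last = x , ch , x≤q , q≤last
    ... | no  q≰last = chain-covers ch′ (subst (_≤ q) followed (≰⇒> q≰last)) q<end

    chain-span-below : ∀ {x c y q} (ch : Chain w A x c) → first x ≤ q → q < chainEnd ch → c Fin.≤ y →
                       ¬ w ‼ q ≡ just y
    chain-span-below ch x≤q q<end c≤y with chain-covers ch x≤q q<end
    ... | z , chz , q∈z = larger-∉-block (<-≤-trans (Chain⇒< chz) c≤y) q∈z

    chainEnd≡first : ∀ {x b} (ch : Chain w A x b) → first x ≤ first b → chainEnd ch ≡ first b
    chainEnd≡first {b = b} ch x≤b with first b <? chainEnd ch
    ... | yes b<end = ⊥-elim (chain-span-below ch x≤b b<end Finₚ.≤-refl (‼-first b))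
    ... | no  b≮end = ≤-antisym (≮⇒≥ b≮end) (first-≤ (‼-chainEnd ch))

    chain-from-enclosing : ∀ {x y c} → Chain w A x c → x Fin.≤ y → y Fin.< c → BlockIn w x y → Chain w A y c
    chain-from-enclosing {x} {y} ch x≤y y<c x⊆y with x ≟ y
    ... | yes refl = ch
    ... | no  x≢y  = from ch
      where
      successor∈y : InBlock y (suc (last x))
      successor∈y = ≤-trans (proj₁ x⊆y) (≤-trans (first≤last x) (n≤1+n _))
                  , ≤∧≢⇒< (proj₂ x⊆y) (x≢y ∘ last-injective)
      from : Chain w A x _ → Chain w A y _
      from (lastStep _ followed _) = ⊥-elim (larger-∉-block y<c successor∈y followed)
      from (step {b' = x′} _ followed _ ch′) with <-cmp x′ y
      ... | tri< x′<y _ _ = chain-from-enclosing ch′ (<⇒≤ x′<y) y<c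
                              (blocks-nested x′<y (≤-refl , first≤last x′) (subst (InBlock y) followed successor∈y))
      ... | tri≈ _ refl _ = ch′
      ... | tri> _ _ y<x′ = ⊥-elim (larger-∉-block y<x′ (subst (InBlock y) followed successor∈y) (‼-first x′))

    chain-++ : ∀ {x b c} (ch₁ : Chain w A x b) → chainEnd ch₁ ≡ first b → (ch₂ : Chain w A b c) →
               Σ (Chain w A x c) λ ch → chainEnd ch ≡ chainEnd ch₂
    chain-++ (lastStep x<b _ Axb) end≡first ch₂ = step x<b end≡first Axb ch₂ , refl
    chain-++ (step x<x′ followed Axx′ ch₁) end≡first ch₂ with chain-++ ch₁ end≡first ch₂
    ... | ch , end≡ = step x<x′ followed Axx′ ch , end≡

module Dependence {n} (s : Fin n → ℕ) (composition : IsComposition s)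
                  (w : List (Fin n)) (stirling : StirlingPerm s w) (A : Fin n → Fin n → Set) where

  open Blocks w (λ x → subst (1 ≤_) (sym (proj₁ stirling x)) (composition x)) (proj₂ stirling)

  Dep : Fin n → Fin n → Set
  Dep = Dependent s w A

  -- #_w(b,a) + [(a,b) is A-dependent], the value the theorem predicts for #_{w+A}(b,a), is positive
  ClosurePositive : Fin n → Fin n → Set
  ClosurePositive a b = 0 < inv w b a ⊎ Dep a b

  inv<s : ∀ {a c q} → w ‼ q ≡ just c → first a ≤ q → inv w c a < s c
  inv<s {c = c} {q} w[q]≡c a≤q =
    <-≤-trans (count-take-< c w w[q]≡c a≤q (ℕₚ.n<1+n q))
              (≤-trans (count-take-≤ c w (suc q)) (ℕₚ.≤-reflexive (proj₁ stirling c)))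

  EnclosingBelow : Fin n → Fin n → Fin n → Set
  EnclosingBelow a c y = y Fin.< c × BlockIn w a y

  enclosingBelow? : ∀ a c y → Dec (EnclosingBelow a c y)
  enclosingBelow? a c y = y Fin.<? c ×-dec (first y ≤? first a ×-dec last a ≤? last y)

  dependent-of-enclosing-chain : ∀ {a c z} → a Fin.< c → inv w c a < s c → Chain w A z c → BlockIn w a z →
                                 Dep a c
  dependent-of-enclosing-chain {a} {c} {z} a<c inv<s chz a⊆z
    with ∃-largest (enclosingBelow? a c) (a<c , BlockIn-refl)
  ... | b₁ , (b₁<c , a⊆b₁) , largest =
    a<c , inv<s , b₁ , largest a (a<c , BlockIn-refl) , b₁<c , a⊆b₁ , (λ b b<c a⊆b → largest b (b<c , a⊆b)) ,
    chain-from-enclosing chz z≤b₁ b₁<c (BlockIn-join a⊆z a⊆b₁ z≤b₁)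
    where
    z≤b₁ : z Fin.≤ b₁
    z≤b₁ = largest z (Chain⇒< chz , a⊆z)

  ascent⇒followed : ∀ {a c} → Ascent w a c → BlockFollowedByLetter w a c
  ascent⇒followed {a} {c} (a<c , u , v , w≡uacv) = subst (λ q → w ‼ suc q ≡ just c) (sym last≡p) w[p+1]≡c
    where
    p : ℕ
    p = length u + 0
    at : ∀ j → w ‼ (length u + j) ≡ (a ∷ c ∷ v) ‼ j
    at j = trans (cong (_‼ (length u + j)) w≡uacv) (‼-++ʳ u (a ∷ c ∷ v) j)
    w[p+1]≡c : w ‼ suc p ≡ just c
    w[p+1]≡c = trans (cong (w ‼_) (sym (ℕₚ.+-suc (length u) 0))) (at 1)
    last≤p : last a ≤ p
    last≤p with last a ≤? p
    ... | yes le  = le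
    ... | no  nle = ⊥-elim (larger-∉-block a<c (≤-trans (first-≤ (at 0)) (n≤1+n p) , ≰⇒> nle) w[p+1]≡c)
    last≡p : last a ≡ p
    last≡p = ≤-antisym last≤p (≤-last (at 0))

  ascent⇒dependent : ∀ {a c} → Ascent w a c → A a c → Dep a c
  ascent⇒dependent {a} {c} ascent@(a<c , _) Aac =
    dependent-of-enclosing-chain a<c (inv<s followed (≤-trans (first≤last a) (n≤1+n _)))
      (lastStep a<c followed Aac) BlockIn-refl
    where
    followed : BlockFollowedByLetter w a c
    followed = ascent⇒followed ascent

  dependent-via-chain : ∀ {a c x} → a Fin.< c → inv w c a < s c → (ch : Chain w A x c) →
                        first x ≤ first a → first a < chainEnd ch → Dep a c
  dependent-via-chain a<c inv<s ch x≤a a<end with chain-covers ch x≤a a<end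
  ... | z , chz , a∈z = dependent-of-enclosing-chain a<c inv<s chz (first-∈-block⇒BlockIn a∈z)

  inv-antitone : ∀ {a b c} → b Fin.< c → ClosurePositive a b → inv w c b ≤ inv w c a
  inv-antitone {a} {b} {c} _ (inj₁ 0<inv) = count-take-mono c w (<⇒≤ (count-take-pos⇒firstOcc< b w (first a) 0<inv))
  inv-antitone {a} {b} {c} b<c (inj₂ (_ , _ , γ , _ , _ , (γ≤a , _) , _ , chγ)) with first b ≤? first a
  ... | yes b≤a = count-take-mono c w b≤a
  ... | no  _   = count-take-gap c w (first a) (first b) λ r a≤r r<b →
                    chain-span-below chγ (≤-trans γ≤a a≤r) (<-≤-trans r<b (first-≤ (‼-chainEnd chγ)))
                      (<⇒≤ b<c)

  inv≡⇒first< : ∀ {a b c q} → w ‼ q ≡ just c → a Fin.< c → first b ≤ q → inv w c b ≡ inv w c a →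
                first a < q
  inv≡⇒first< {a} {c = c} {q} w[q]≡c a<c b≤q inv≡ with first a <? q
  ... | yes a<q = a<q
  ... | no  a≮q = ⊥-elim (ℕₚ.<-irrefl inv≡ (count-take-< c w w[q]≡c b≤q q<a))
    where
    q<a : q < first a
    q<a = ≤∧≢⇒< (≮⇒≥ a≮q) λ q≡a →
            Finₚ.<⇒≢ a<c (‼-functional (‼-first a) (subst (λ p → w ‼ p ≡ just c) q≡a w[q]≡c))

  SpanningChain : Fin n → Fin n → Fin n → Set
  SpanningChain a b c = ∃ λ x → Σ (Chain w A x c) λ ch → first x ≤ first a × first b ≤ chainEnd ch

  chain-through-dependence : ∀ {a b c β} → ClosurePositive a b → first a < first β →
                             b Fin.≤ β → BlockIn w b β → Chain w A β c → SpanningChain a b c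
  chain-through-dependence {a} {b} (inj₁ 0<inv) a<β _ (β≤b , _) _ =
    ⊥-elim (ℕₚ.<-asym (count-take-pos⇒firstOcc< b w (first a) 0<inv) (<-≤-trans a<β β≤b))
  chain-through-dependence {a} {b} {c} {β} (inj₂ (_ , _ , γ , _ , _ , (γ≤a , _) , _ , chγ))
                           a<β b≤β (β≤b , _) chβ
    with b ≟ β | chainEnd≡first chγ (≤-trans γ≤a (≤-trans (<⇒≤ a<β) β≤b))
  ... | yes refl | end≡first =
    γ , proj₁ joined , γ≤a ,
    subst (first b ≤_) (sym (proj₂ joined)) (≤-trans (first≤last b) (<⇒≤ (last<chainEnd chβ)))
    where
    joined : Σ (Chain w A γ c) λ ch → chainEnd ch ≡ chainEnd chβ
    joined = chain-++ chγ end≡first chβ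
  ... | no  b≢β  | end≡first =
    ⊥-elim (chain-span-below chγ (≤-trans γ≤a (<⇒≤ a<β)) (subst (first β <_) (sym end≡first) β<b)
              (<⇒≤ (Finₚ.≤∧≢⇒< b≤β b≢β)) (‼-first β))
    where
    β<b : first β < first b
    β<b = ≤∧≢⇒< β≤b (λ eq → b≢β (sym (first-injective eq)))

  chain-spanning : ∀ {a b c β} → ClosurePositive a b → b Fin.≤ β → BlockIn w b β → Chain w A β c →
                   SpanningChain a b c
  chain-spanning {a} {b} {β = β} pos b≤β b⊆β chβ with first β ≤? first a
  ... | yes β≤a = β , chβ , β≤a , ≤-trans (first≤last b) (≤-trans (proj₂ b⊆β) (<⇒≤ (last<chainEnd chβ)))
  ... | no  β≰a = chain-through-dependence pos (≰⇒> β≰a) b≤β b⊆β chβ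

  dependent-trans : ∀ {a b c} → a Fin.< b → b Fin.< c → ClosurePositive a b → Dep b c →
                    inv w c b ≡ inv w c a → Dep a c
  dependent-trans {a} {b} {c} a<b b<c pos (_ , inv<s , β , b≤β , _ , b⊆β , _ , chβ) inv≡
    with chain-spanning pos b≤β b⊆β chβ
  ... | x , ch , x≤a , b≤end =
    dependent-via-chain a<c (subst (_< _) inv≡ inv<s) ch x≤a (inv≡⇒first< (‼-chainEnd ch) a<c b≤end inv≡)
    where
    a<c : a Fin.< c
    a<c = Finₚ.<-trans a<b b<c

  module Closure (A⊆ascents : ∀ a c → A a c → Ascent w a c)
                 (I : Fin n → Fin n → ℕ) (closure : IsTransClosure w A I) where

    inv≤I : ∀ {a c} → a Fin.< c → inv w c a ≤ I c a
    inv≤I = proj₁ (proj₁ closure) _ _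

    A⇒inv<I : ∀ {a c} → a Fin.< c → A a c → suc (inv w c a) ≤ I c a
    A⇒inv<I = proj₁ (proj₂ (proj₁ closure)) _ _

    I-transitive : ∀ {a b c} → a Fin.< b → b Fin.< c → I b a ≡ 0 ⊎ I c b ≤ I c a
    I-transitive = proj₂ (proj₂ (proj₁ closure)) _ _ _

    I-transitive⁺ : ∀ {a b c} → a Fin.< b → b Fin.< c → 0 < I b a → I c b ≤ I c a
    I-transitive⁺ a<b b<c 0<I with I-transitive a<b b<c
    ... | inj₁ I≡0 = ⊥-elim (ℕₚ.<-irrefl (sym I≡0) 0<I)
    ... | inj₂ le  = le

    lowered : Fin n → Fin n → ℕ → Fin n → Fin n → ℕ
    lowered c a m y x with y ≟ c | x ≟ a
    ... | yes _ | yes _ = m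
    ... | _     | _     = I y x

    lowered-cases : ∀ c a m y x → (y ≡ c × x ≡ a × lowered c a m y x ≡ m) ⊎ lowered c a m y x ≡ I y x
    lowered-cases c a m y x with y ≟ c | x ≟ a
    ... | yes y≡c | yes x≡a = inj₁ (y≡c , x≡a , refl)
    ... | yes _   | no  _   = inj₂ refl
    ... | no  _   | _       = inj₂ refl

    lowered-at : ∀ c a m → lowered c a m c a ≡ m
    lowered-at c a m with c ≟ c | a ≟ a
    ... | yes _  | yes _  = refl
    ... | yes _  | no a≢a = ⊥-elim (a≢a refl)
    ... | no c≢c | _      = ⊥-elim (c≢c refl)

    lowered-above : ∀ {a c m} → a Fin.< c → m < I c a → inv w c a ≤ m → (A a c → suc (inv w c a) ≤ m) →
                    (∀ b → a Fin.< b → b Fin.< c → ¬ I b a ≡ 0 → I c b ≤ m) →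
                    AboveInvPlusA w A (lowered c a m)
    lowered-above {a} {c} {m} a<c m<I inv≤m A⇒inv<m bound = above-inv , above-A , transitive
      where
      above-inv : ∀ x y → x Fin.< y → inv w y x ≤ lowered c a m y x
      above-inv x y x<y with lowered-cases c a m y x
      ... | inj₁ (refl , refl , eq) = subst (inv w c a ≤_) (sym eq) inv≤m
      ... | inj₂ eq                 = subst (inv w y x ≤_) (sym eq) (inv≤I x<y)
      above-A : ∀ x y → x Fin.< y → A x y → suc (inv w y x) ≤ lowered c a m y x
      above-A x y x<y Axy with lowered-cases c a m y x
      ... | inj₁ (refl , refl , eq) = subst (suc (inv w c a) ≤_) (sym eq) (A⇒inv<m Axy)
      ... | inj₂ eq                 = subst (suc (inv w y x) ≤_) (sym eq) (A⇒inv<I x<y Axy)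
      transitive : ∀ x y z → x Fin.< y → y Fin.< z →
                   lowered c a m y x ≡ 0 ⊎ lowered c a m z y ≤ lowered c a m z x
      transitive x y z x<y y<z with lowered-cases c a m y x | lowered-cases c a m z y | lowered-cases c a m z x
      ... | inj₁ (refl , refl , _) | inj₁ (refl , _ , _) | _ = ⊥-elim (Finₚ.<-irrefl refl y<z)
      ... | inj₁ (refl , refl , _) | inj₂ _ | inj₁ (refl , _ , _) = ⊥-elim (Finₚ.<-irrefl refl y<z)
      ... | inj₁ (refl , refl , _) | inj₂ zy | inj₂ zx =
        inj₂ (subst₂ _≤_ (sym zy) (sym zx) (I-transitive⁺ a<c y<z (≤-<-trans z≤n m<I)))
      ... | inj₂ _ | inj₁ (refl , refl , _) | inj₁ (_ , refl , _) = ⊥-elim (Finₚ.<-irrefl refl x<y)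
      ... | inj₂ yx | inj₁ (refl , refl , zy) | inj₂ zx with I-transitive x<y y<z
      ...   | inj₁ I≡0 = inj₁ (trans yx I≡0)
      ...   | inj₂ le  = inj₂ (subst₂ _≤_ (sym zy) (sym zx) (≤-trans (<⇒≤ m<I) le))
      transitive x y z x<y y<z | inj₂ yx | inj₂ zy | inj₁ (refl , refl , zx) with I y a ℕ.≟ 0
      ...   | yes I≡0 = inj₁ (trans yx I≡0)
      ...   | no  I≢0 = inj₂ (subst₂ _≤_ (sym zy) (sym zx) (bound y x<y y<z I≢0))
      transitive x y z x<y y<z | inj₂ yx | inj₂ zy | inj₂ zx with I-transitive x<y y<z
      ...   | inj₁ I≡0 = inj₁ (trans yx I≡0)
      ...   | inj₂ le  = inj₂ (subst₂ _≤_ (sym zy) (sym zx) le)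

    closure-≤ : ∀ {a c m} → a Fin.< c → inv w c a ≤ m → (A a c → suc (inv w c a) ≤ m) →
                (∀ b → a Fin.< b → b Fin.< c → ¬ I b a ≡ 0 → I c b ≤ m) → I c a ≤ m
    closure-≤ {a} {c} {m} a<c inv≤m A⇒inv<m bound with I c a ≤? m
    ... | yes I≤m = I≤m
    ... | no  I≰m = ⊥-elim (I≰m (subst (I c a ≤_) (lowered-at c a m)
                      (proj₂ closure (lowered c a m) (lowered-above a<c (≰⇒> I≰m) inv≤m A⇒inv<m bound) a c a<c)))

    chain⇒inv<I : ∀ {x c} → Chain w A x c → suc (inv w c x) ≤ I c x
    chain⇒inv<I (lastStep x<c _ Axc) = A⇒inv<I x<c Axc
    chain⇒inv<I {x} {c} (step {b' = x′} x<x′ followed Axx′ ch) =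
      ≤-trans (s≤s (count-take-mono c w x≤x′))
              (≤-trans (chain⇒inv<I ch)
                       (I-transitive⁺ x<x′ (Chain⇒< ch) (≤-<-trans z≤n (A⇒inv<I x<x′ Axx′))))
      where
      x≤x′ : first x ≤ first x′
      x≤x′ = ≤-trans (first≤last x) (≤-trans (n≤1+n _) (ℕₚ.≤-reflexive followed))

    dependent⇒inv<I : ∀ {a c} → Dep a c → suc (inv w c a) ≤ I c a
    dependent⇒inv<I {a} {c} (_ , _ , b₁ , a≤b₁ , b₁<c , a⊆b₁ , _ , ch) with a ≟ b₁
    ... | yes refl = chain⇒inv<I ch
    ... | no  a≢b₁ = ≤-trans (s≤s inv≤) (≤-trans (chain⇒inv<I ch) (I-transitive⁺ a<b₁ b₁<c 0<I))
      where
      a<b₁ : a Fin.< b₁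
      a<b₁ = Finₚ.≤∧≢⇒< a≤b₁ a≢b₁
      b₁<a : first b₁ < first a
      b₁<a = ≤∧≢⇒< (proj₁ a⊆b₁) (λ eq → a≢b₁ (sym (first-injective eq)))
      0<I : 0 < I b₁ a
      0<I = <-≤-trans (≤-<-trans z≤n (count-take-< b₁ w (‼-first b₁) ≤-refl b₁<a)) (inv≤I a<b₁)
      inv≤ : inv w c a ≤ inv w c b₁
      inv≤ = count-take-gap c w (first b₁) (first a) λ r b₁≤r r<a →
               larger-∉-block b₁<c (b₁≤r , ≤-trans (<⇒≤ r<a) (≤-trans (first≤last a) (proj₂ a⊆b₁)))

    ClosureBounds : Fin n → Fin n → Set
    ClosureBounds a c = I c a ≤ suc (inv w c a) × (¬ Dep a c → I c a ≤ inv w c a)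

    closure-nonzero : ∀ {a b} → ClosureBounds a b → ¬ I b a ≡ 0 → ¬ ¬ ClosurePositive a b
    closure-nonzero (_ , independent) I≢0 ¬pos =
      I≢0 (ℕₚ.n≤0⇒n≡0 (≤-trans (independent (¬pos ∘ inj₂)) (≮⇒≥ (¬pos ∘ inj₁))))

    closure-bounds-step : ∀ {a c} → a Fin.< c →
                          (∀ {a′ c′} → c′ Fin.< c → a′ Fin.< c′ → ClosureBounds a′ c′) →
                          (∀ {b} → a Fin.< b → b Fin.< c → ClosureBounds b c) → ClosureBounds a c
    closure-bounds-step {a} {c} a<c earlier later = at-most-one-more , independent
      where
      at-most-one-more : I c a ≤ suc (inv w c a)
      at-most-one-more = closure-≤ a<c (n≤1+n _) (λ _ → ≤-refl) λ b a<b b<c I≢0 →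
        decidable-stable (I c b ≤? suc (inv w c a)) λ I≰ →
          closure-nonzero (earlier b<c a<b) I≢0 λ pos →
            I≰ (≤-trans (proj₁ (later a<b b<c)) (s≤s (inv-antitone b<c pos)))
      independent : ¬ Dep a c → I c a ≤ inv w c a
      independent ¬dep = closure-≤ a<c ≤-refl (λ Aac → ⊥-elim (¬dep (ascent⇒dependent (A⊆ascents a c Aac) Aac)))
        λ b a<b b<c I≢0 → decidable-stable (I c b ≤? inv w c a) λ I≰ →
          closure-nonzero (earlier b<c a<b) I≢0 λ pos →
            ¬¬-excluded-middle (I≰ ∘ bounded a<b b<c pos)
        where
        bounded : ∀ {b} → a Fin.< b → b Fin.< c → ClosurePositive a b → Dec (Dep b c) → I c b ≤ inv w c a
        bounded a<b b<c pos (no ¬dep′) = ≤-trans (proj₂ (later a<b b<c) ¬dep′) (inv-antitone b<c pos)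
        bounded a<b b<c pos (yes dep′) with m≤n⇒m<n∨m≡n (inv-antitone b<c pos)
        ... | inj₁ inv< = ≤-trans (proj₁ (later a<b b<c)) inv<
        ... | inj₂ inv≡ = ⊥-elim (¬dep (dependent-trans a<b b<c pos dep′ inv≡))

    closure-bounds : ∀ {a c} → Acc Fin._<_ c → Acc Fin._>_ a → a Fin.< c → ClosureBounds a c
    closure-bounds c-acc@(acc smaller) (acc larger) a<c = closure-bounds-step a<c
      (λ c′<c a′<c′ → closure-bounds (smaller c′<c) (>-wellFounded _) a′<c′)
      (λ a<b b<c → closure-bounds c-acc (larger a<b) b<c)

proposition3p12 : ∀ {n} (s : Fin n → ℕ) → IsComposition s →
    (w : List (Fin n)) → StirlingPerm s w →
    (A : Fin n → Fin n → Set) → (∀ a c → A a c → Ascent w a c) →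
    (wA : List (Fin n)) → StirlingPerm s wA → IsTransClosure w A (inv wA) →
    ∀ a c → a Fin.< c →
      (Dependent s w A a c → inv wA c a ≡ suc (inv w c a)) ×
      (¬ Dependent s w A a c → inv wA c a ≡ inv w c a)
proposition3p12 s composition w stirling A A⊆ascents wA _ closure a c a<c =
    (λ dep → ≤-antisym (proj₁ bounds) (dependent⇒inv<I dep))
  , (λ ¬dep → ≤-antisym (proj₂ bounds ¬dep) (inv≤I a<c))
  where
  open Dependence s composition w stirling A
  open Closure A⊆ascents (inv wA) closure
  bounds : ClosureBounds a c
  bounds = closure-bounds (<-wellFounded c) (>-wellFounded a) a<c
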